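{- Let $n=(2k+1)^2$ for a nonnegative integer $k$. (i) There exists a graph $H_1$ of order $n$ such that $\chi_{\mathrm{so}}(H_1)=\sqrt n$ and $\chi_{\mathrm{so}}(\overline{H_1})=\sqrt n$. (ii) There exists a graph $H_2$ of order $n$ such that $\chi_{\mathrm{so}}(H_2)=n$ and $\chi_{\mathrm{so}}(\overline{H_2})=n$. (iii) For every graph $G$ on $n$ vertices, $2\sqrt n\leq \chi_{\mathrm{so}}(G)+\chi_{\mathrm{so}}(\overline G)\leq 2n$ and $n\leq \chi_{\mathrm{so}}(G)\cdot\chi_{\mathrm{so}}(\overline G)\leq n^2$, and all four of these inequalities are attained with equality by some graph on $n$ vertices.
   Context: Graphs are finite and simple; $\overline{G}$ denotes the complement of $G$. A strong odd coloring of a graph $G$ is a proper vertex coloring such that for every vertex $v$ and every color $c$, the number of neighbors of $v$ colored $c$ is either $0$ or odd; $\chi_{\mathrm{so}}(G)$ is the minimum number of colors in such a coloring. -}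

module Defs where

open import Data.Nat using (ℕ; zero; suc; _+_; _*_; _≤_; _%_)
open import Data.Bool using (Bool; true; false; not; _∧_; if_then_else_)
open import Data.Fin using (Fin; _≟_)
open import Data.List using (List; map; allFin)
open import Data.Nat.ListAction using (sum)
open import Data.Product using (_×_)
open import Data.Sum using (_⊎_)
open import Relation.Nullary using (¬_)
open import Relation.Nullary.Decidable using (⌊_⌋)
open import Relation.Binary.PropositionalEquality using (_≡_)

record Graph (n : ℕ) : Set where
  field
    adj    : Fin n → Fin n → Bool
    adj-sym : ∀ u v → adj u v ≡ adj v u
    irrefl : ∀ v → adj v v ≡ false
open Graph public

complement : ∀ {n} → Graph n → Graph n
complement {n} G = record { adj = a ; adj-sym = s ; irrefl = i }
  where
  open import Relation.Binary.PropositionalEquality using (refl; sym; cong; trans)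
  open import Relation.Nullary using (yes; no)
  a : Fin n → Fin n → Bool
  a u v = if ⌊ u ≟ v ⌋ then false else not (Graph.adj G u v)
  s : ∀ u v → a u v ≡ a v u
  s u v with u ≟ v | v ≟ u
  ... | yes _ | yes _ = refl
  ... | yes p | no q = Data.Empty.⊥-elim (q (sym p)) where import Data.Empty
  ... | no p | yes q = Data.Empty.⊥-elim (p (sym q)) where import Data.Empty
  ... | no _ | no _ = cong not (Graph.adj-sym G u v)
  i : ∀ v → a v v ≡ false
  i v with v ≟ v
  ... | yes _ = refl
  ... | no p = Data.Empty.⊥-elim (p refl) where import Data.Empty

colourCount : ∀ {n c} → Graph n → (Fin n → Fin c) → Fin n → Fin c → ℕ
colourCount {n} G f v col =
  sum (map (λ u → if adj G v u ∧ ⌊ f u ≟ col ⌋ then 1 else 0) (allFin n))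

Proper : ∀ {n c} → Graph n → (Fin n → Fin c) → Set
Proper G f = ∀ u v → adj G u v ≡ true → ¬ (f u ≡ f v)

IsStrongOddColouring : ∀ {n c} → Graph n → (Fin n → Fin c) → Set
IsStrongOddColouring G f =
  Proper G f × (∀ v col → colourCount G f v col ≡ 0 ⊎ colourCount G f v col % 2 ≡ 1)

HasSOC : ∀ {n} → Graph n → ℕ → Set
HasSOC {n} G c = Data.Product.Σ (Fin n → Fin c) (IsStrongOddColouring G)
  where import Data.Product

χso≡ : ∀ {n} → Graph n → ℕ → Set
χso≡ G m = HasSOC G m × (∀ c → HasSOC G c → m ≤ c)

-- Write m = 2k+1 and view the vertices as the cells of an m × m grid.
-- H₁ = mK_m (the rows as disjoint cliques) is strongly odd coloured by columns, and its complement, the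
-- complete multipartite graph with the rows as parts, by rows: every vertex then sees each foreign colour
-- exactly m times, which is odd.  Rows resp. columns are cliques, so m colours are needed.
-- H₂ = K_m □ K_m (the rook's graph) and its complement K_m × K_m admit only injective strong odd colourings.
-- In the rook's graph two equally coloured vertices in different rows and columns have a common neighbour
-- that sees exactly two vertices of their colour.  In K_m × K_m, two equally coloured vertices in one row
-- confine their colour class to that row, and counting the class from the cells of another row yields two
-- consecutive odd numbers.
-- For (iii): the identity is a strong odd colouring, so a, b ≤ n; the pair of colourings of G and its
-- complement is an injective colouring, so n ≤ ab; and AM-GM turns n ≤ ab into 2√n ≤ a + b.

module Submission where

open import Defs
open import Data.Nat using (ℕ; _+_; _*_; _≤_; _^_)
open import Data.Product using (_×_; ∃-syntax)
open import Relation.Binary.PropositionalEquality using (_≡_)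

open import Data.Nat.Properties using (+-0-commutativeMonoid)
open import Algebra.Properties.CommutativeMonoid.Sum +-0-commutativeMonoid
  using (sum; sum-syntax; sum-remove; sum-cong-≗; sum-replicate-zero; ∑-comm)
open import Data.Bool using (Bool; true; false; not; _∧_; if_then_else_)
open import Data.Bool.Properties using (∧-zeroʳ)
open import Data.Empty using (⊥-elim)
open import Data.Fin using (Fin; zero; suc; _≟_; _↑ˡ_; _↑ʳ_; combine; quotient; remainder; punchIn; punchOut)
open import Data.Fin.Properties
  using (injective⇒≤; combine-injectiveˡ; combine-injectiveʳ; remQuot-combine; combine-remQuot;
         punchInᵢ≢i; punchIn-punchOut; punchIn-injective; all?; ¬∀⟶∃¬)
open import Data.List using (tabulate)
open import Data.List.Properties using (map-tabulate)
import Data.Nat.ListAction as List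
open import Data.Nat using (zero; suc; _∸_; _%_; _<_; z≤n; z<s)
open import Data.Nat.DivMod using (%-distribˡ-+; [m+kn]%n≡m%n)
open import Data.Nat.Properties
  using (+-identityʳ; +-assoc; +-comm; *-comm; *-identityʳ; m≤m+n; +-mono-≤; *-mono-≤; *-monoʳ-≤; *-mono-<;
         ≤-total; ≤-trans; <⇒≱; ≮⇒≥; m+[n∸m]≡n)
open import Data.Nat.Solver using (module +-*-Solver)
open import Data.Product using (Σ; _,_; proj₁; proj₂; swap)
open import Data.Sum using (_⊎_; inj₁; inj₂)
open import Function using (id; _∘_; _⇔_; mk⇔; Equivalence)
open import Function.Definitions using (Injective)
open import Relation.Binary.PropositionalEquality
  using (refl; sym; trans; cong; cong₂; subst; subst₂; _≢_; module ≡-Reasoning)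
open import Relation.Nullary using (¬_; Dec; yes; no; does)
open import Relation.Nullary.Decidable
  using (⌊_⌋; dec-true; dec-false; does-⇔; isYes≗does; decidable-stable; ¬?; _×-dec_; _⊎-dec_)

open Equivalence using (to; from)
open ≡-Reasoning

-- Finite sums

indicator : Bool → ℕ
indicator b = if b then 1 else 0

indicator-yes : ∀ {P : Set} (p? : Dec P) → P → indicator ⌊ p? ⌋ ≡ 1
indicator-yes (yes _) _ = refl
indicator-yes (no ¬p) p = ⊥-elim (¬p p)

indicator-no : ∀ {P : Set} (p? : Dec P) → ¬ P → indicator ⌊ p? ⌋ ≡ 0
indicator-no (yes p) ¬p = ⊥-elim (¬p p)
indicator-no (no _) _ = refl

indicator-∧-no : ∀ b {P : Set} (p? : Dec P) → ¬ P → indicator (b ∧ ⌊ p? ⌋) ≡ 0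
indicator-∧-no b (yes p) ¬p = ⊥-elim (¬p p)
indicator-∧-no b (no _) _ = cong indicator (∧-zeroʳ b)

indicator-⇔ : ∀ {P Q : Set} → P ⇔ Q → (p? : Dec P) (q? : Dec Q) → indicator ⌊ p? ⌋ ≡ indicator ⌊ q? ⌋
indicator-⇔ P⇔Q p? q? = cong indicator (trans (isYes≗does p?) (trans (does-⇔ P⇔Q p? q?) (sym (isYes≗does q?))))

List-sum-tabulate : ∀ {n} (f : Fin n → ℕ) → List.sum (tabulate f) ≡ sum f
List-sum-tabulate {zero} f = refl
List-sum-tabulate {suc n} f = cong (f zero +_) (List-sum-tabulate (f ∘ suc))

∑-zero : ∀ {n} {f : Fin n → ℕ} → (∀ i → f i ≡ 0) → sum f ≡ 0
∑-zero {n} f≡0 = trans (sum-cong-≗ f≡0) (sum-replicate-zero n)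

∑-ones : ∀ n → ∑[ i < n ] 1 ≡ n
∑-ones zero = refl
∑-ones (suc n) = cong suc (∑-ones n)

∑-single : ∀ {n} {f : Fin n → ℕ} t → (∀ i → i ≢ t → f i ≡ 0) → sum f ≡ f t
∑-single {suc n} {f} t off = begin
  sum f                    ≡⟨ sum-remove f ⟩
  f t + sum (f ∘ punchIn t) ≡⟨ cong (f t +_) (∑-zero (λ j → off _ (punchInᵢ≢i t j))) ⟩
  f t + 0                  ≡⟨ +-identityʳ (f t) ⟩
  f t                      ∎

∑-pair : ∀ {n} {f : Fin n → ℕ} {u v} → u ≢ v → (∀ i → i ≢ u → i ≢ v → f i ≡ 0) → sum f ≡ f u + f v
∑-pair {suc n} {f} {u} {v} u≢v off = begin
  sum f                               ≡⟨ sum-remove f ⟩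
  f u + sum (f ∘ punchIn u)            ≡⟨ cong (f u +_) (∑-single v′ off′) ⟩
  f u + f (punchIn u v′)               ≡⟨ cong (λ w → f u + f w) (punchIn-punchOut u≢v) ⟩
  f u + f v                           ∎
  where
  v′ : Fin n
  v′ = punchOut u≢v
  off′ : ∀ j → j ≢ v′ → f (punchIn u j) ≡ 0
  off′ j j≢v′ = off _ (punchInᵢ≢i u j) λ eq →
    j≢v′ (punchIn-injective u j v′ (trans eq (sym (punchIn-punchOut u≢v))))

∑-≥ : ∀ {n} (f : Fin n → ℕ) t → f t ≤ sum f
∑-≥ {suc n} f t = subst (f t ≤_) (sym (sum-remove f)) (m≤m+n _ _)

∑-except : ∀ {n} {f g : Fin n → ℕ} t → g t ≡ 0 → (∀ i → i ≢ t → f i ≡ g i) → sum f ≡ f t + sum g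
∑-except {suc n} {f} {g} t gt≡0 agree = begin
  sum f                       ≡⟨ sum-remove f ⟩
  f t + sum (f ∘ punchIn t)    ≡⟨ cong (f t +_) (sum-cong-≗ (λ j → agree _ (punchInᵢ≢i t j))) ⟩
  f t + sum (g ∘ punchIn t)    ≡⟨ cong (λ x → f t + (x + sum (g ∘ punchIn t))) gt≡0 ⟨
  f t + (g t + sum (g ∘ punchIn t)) ≡⟨ cong (f t +_) (sum-remove g) ⟨
  f t + sum g                 ∎

∑-↑ : ∀ a {b} (f : Fin (a + b) → ℕ) → sum f ≡ sum (f ∘ (_↑ˡ b)) + sum (f ∘ (a ↑ʳ_))
∑-↑ zero f = refl
∑-↑ (suc a) f = trans (cong (f zero +_) (∑-↑ a (f ∘ suc))) (sym (+-assoc (f zero) _ _))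

∑-combine : ∀ a {b} (f : Fin (a * b) → ℕ) → sum f ≡ ∑[ i < a ] ∑[ j < b ] f (combine i j)
∑-combine zero f = refl
∑-combine (suc a) {b} f = trans (∑-↑ b f) (cong (sum (f ∘ (_↑ˡ a * b)) +_) (∑-combine a (f ∘ (b ↑ʳ_))))

ZeroOrOdd : ℕ → Set
ZeroOrOdd k = k ≡ 0 ⊎ k % 2 ≡ 1

indicator-zeroOrOdd : ∀ b → ZeroOrOdd (indicator b)
indicator-zeroOrOdd true = inj₂ refl
indicator-zeroOrOdd false = inj₁ refl

¬zeroOrOdd-2 : ¬ ZeroOrOdd 2
¬zeroOrOdd-2 (inj₁ ())
¬zeroOrOdd-2 (inj₂ ())

zeroOrOdd⇒odd : ∀ {k} → 0 < k → ZeroOrOdd k → k % 2 ≡ 1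
zeroOrOdd⇒odd 0<k (inj₁ refl) = ⊥-elim (<⇒≱ 0<k z≤n)
zeroOrOdd⇒odd 0<k (inj₂ odd) = odd

odd⇒suc-even : ∀ k → k % 2 ≡ 1 → suc k % 2 ≢ 1
odd⇒suc-even k k-odd sk-odd with () ← begin
  0                    ≡⟨ cong (λ r → (r + 1 % 2) % 2) k-odd ⟨
  (k % 2 + 1 % 2) % 2  ≡⟨ %-distribˡ-+ k 1 2 ⟨
  (k + 1) % 2          ≡⟨ cong (_% 2) (+-comm k 1) ⟩
  suc k % 2            ≡⟨ sk-odd ⟩
  1                    ∎

2k+1-odd : ∀ k → (2 * k + 1) % 2 ≡ 1
2k+1-odd k = trans (cong (_% 2) (trans (+-comm (2 * k) 1) (cong (1 +_) (*-comm 2 k)))) ([m+kn]%n≡m%n 1 k 2)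

-- Strong odd colourings

colourCount≡sum : ∀ {n c} (G : Graph n) (f : Fin n → Fin c) v col →
  colourCount G f v col ≡ ∑[ u < n ] indicator (adj G v u ∧ ⌊ f u ≟ col ⌋)
colourCount≡sum {n} G f v col =
  trans (cong List.sum (map-tabulate {n = n} id F)) (List-sum-tabulate F)
  where
  F : Fin n → ℕ
  F u = indicator (adj G v u ∧ ⌊ f u ≟ col ⌋)

colourCount-single-zeroOrOdd : ∀ {n c} (G : Graph n) (f : Fin n → Fin c) v col t →
  (∀ x → x ≢ t → adj G v x ≡ true → f x ≢ col) → ZeroOrOdd (colourCount G f v col)
colourCount-single-zeroOrOdd {n} G f v col t only-t =
  subst ZeroOrOdd (sym (trans (colourCount≡sum G f v col) (∑-single t off))) (indicator-zeroOrOdd _)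
  where
  off : ∀ x → x ≢ t → indicator (adj G v x ∧ ⌊ f x ≟ col ⌋) ≡ 0
  off x x≢t with adj G v x in vx
  ... | false = refl
  ... | true = indicator-∧-no true (f x ≟ col) (only-t x x≢t vx)

colourCount≡2 : ∀ {n c} (G : Graph n) (f : Fin n → Fin c) w col {u v} → u ≢ v →
  adj G w u ≡ true → adj G w v ≡ true → f u ≡ col → f v ≡ col →
  (∀ x → x ≢ u → x ≢ v → adj G w x ≡ true → f x ≢ col) → colourCount G f w col ≡ 2
colourCount≡2 {n} G f w col {u} {v} u≢v wu wv fu fv only-uv = begin
  colourCount G f w col  ≡⟨ colourCount≡sum G f w col ⟩
  sum F                   ≡⟨ ∑-pair u≢v off ⟩
  F u + F v               ≡⟨ cong (λ b → indicator (b ∧ ⌊ f u ≟ col ⌋) + F v) wu ⟩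
  indicator ⌊ f u ≟ col ⌋ + F v ≡⟨ cong (λ b → indicator ⌊ f u ≟ col ⌋ + indicator (b ∧ ⌊ f v ≟ col ⌋)) wv ⟩
  indicator ⌊ f u ≟ col ⌋ + indicator ⌊ f v ≟ col ⌋
      ≡⟨ cong (_+ indicator ⌊ f v ≟ col ⌋) (indicator-yes (f u ≟ col) fu) ⟩
  1 + indicator ⌊ f v ≟ col ⌋ ≡⟨ cong (1 +_) (indicator-yes (f v ≟ col) fv) ⟩
  2                       ∎
  where
  F : Fin n → ℕ
  F x = indicator (adj G w x ∧ ⌊ f x ≟ col ⌋)
  off : ∀ x → x ≢ u → x ≢ v → F x ≡ 0
  off x x≢u x≢v with adj G w x in wx
  ... | false = refl
  ... | true = indicator-∧-no true (f x ≟ col) (only-uv x x≢u x≢v wx)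

colourCount-positive : ∀ {n c} (G : Graph n) (f : Fin n → Fin c) w col x →
  adj G w x ≡ true → f x ≡ col → 0 < colourCount G f w col
colourCount-positive {n} G f w col x wx fx = subst (0 <_) (sym (colourCount≡sum G f w col))
  (subst (_≤ sum F) (trans (cong (λ b → indicator (b ∧ ⌊ f x ≟ col ⌋)) wx) (indicator-yes (f x ≟ col) fx))
         (∑-≥ F x))
  where
  F : Fin n → ℕ
  F u = indicator (adj G w u ∧ ⌊ f u ≟ col ⌋)

distinct⇒injective : ∀ {n} {B : Set} {f : Fin n → B} → (∀ {u v} → u ≢ v → f u ≢ f v) → Injective _≡_ _≡_ f
distinct⇒injective clash {u} {v} fu≡fv = decidable-stable (u ≟ v) (λ u≢v → clash u≢v fu≡fv)

id-isStrongOddColouring : ∀ {n} (G : Graph n) → IsStrongOddColouring G id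
id-isStrongOddColouring G = proper , λ v col → colourCount-single-zeroOrOdd G id v col col (λ x x≢col _ → x≢col)
  where
  proper : Proper G id
  proper u _ uu refl with trans (sym (irrefl G u)) uu
  ... | ()

hasSOC-order : ∀ {n} (G : Graph n) → HasSOC G n
hasSOC-order G = id , id-isStrongOddColouring G

χso≡order : ∀ {n} (G : Graph n) →
  (∀ {c} (f : Fin n → Fin c) → IsStrongOddColouring G f → Injective _≡_ _≡_ f) → χso≡ G n
χso≡order G injective = hasSOC-order G , λ c (f , soc) → injective⇒≤ (injective f soc)

clique⇒≤ : ∀ {n m c} (G : Graph n) (h : Fin m → Fin n) →
  (∀ {i j} → i ≢ j → adj G (h i) (h j) ≡ true) → HasSOC G c → m ≤ c
clique⇒≤ G h clique (f , proper , _) = injective⇒≤ (distinct⇒injective λ i≢j → proper _ _ (clique i≢j))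

≤-from-element : ∀ {m c} → (Fin m → m ≤ c) → m ≤ c
≤-from-element {zero} _ = z≤n
≤-from-element {suc m} bound = bound zero

complement-adj⁺ : ∀ {n} (G : Graph n) {u v} → u ≢ v → adj G u v ≡ false → adj (complement G) u v ≡ true
complement-adj⁺ G {u} {v} u≢v uv with u ≟ v
... | yes u≡v = ⊥-elim (u≢v u≡v)
... | no _ = cong not uv

complement-adj⁻ : ∀ {n} (G : Graph n) {u v} → adj (complement G) u v ≡ true → u ≢ v × adj G u v ≡ false
complement-adj⁻ G {u} {v} uv with u ≟ v | adj G u v
complement-adj⁻ G () | yes _ | _
complement-adj⁻ G () | no _ | true
... | no u≢v | false = u≢v , refl

order≤χ*χ̄ : ∀ {n a b} (G : Graph n) → HasSOC G a → HasSOC (complement G) b → n ≤ a * b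
order≤χ*χ̄ G (f , proper , _) (g , proper̄ , _) =
  injective⇒≤ {f = λ x → combine (f x) (g x)} (distinct⇒injective clash)
  where
  clash : ∀ {u v} → u ≢ v → combine (f u) (g u) ≢ combine (f v) (g v)
  clash {u} {v} u≢v eq with adj G u v in uv
  ... | true = proper u v uv (combine-injectiveˡ (f u) (g u) (f v) (g v) eq)
  ... | false = proper̄ u v (complement-adj⁺ G u≢v uv) (combine-injectiveʳ (f u) (g u) (f v) (g v) eq)

does≡true⇒ : ∀ {P : Set} (p? : Dec P) → does p? ≡ true → P
does≡true⇒ (yes p) _ = p

true≢false : true ≢ false
true≢false ()

graphOf : ∀ {n} {R : Fin n → Fin n → Set} → (∀ x y → Dec (R x y)) →
  (∀ {x y} → R x y → R y x) → (∀ x → ¬ R x x) → Graph n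
graphOf R? R-sym R-irrefl = record
  { adj = λ x y → does (R? x y)
  ; adj-sym = λ x y → does-⇔ (mk⇔ R-sym R-sym) (R? x y) (R? y x)
  ; irrefl = λ x → dec-false (R? x x) (R-irrefl x)
  }

-- Grid graphs

record Grid (N m : ℕ) : Set where
  field
    row col : Fin N → Fin m
    cell : Fin m → Fin m → Fin N
    row-cell : ∀ i j → row (cell i j) ≡ i
    col-cell : ∀ i j → col (cell i j) ≡ j
    cell-row-col : ∀ x → cell (row x) (col x) ≡ x
    ∑-cells : ∀ (F : Fin N → ℕ) → sum F ≡ ∑[ i < m ] ∑[ j < m ] F (cell i j)

transpose : ∀ {N m} → Grid N m → Grid N m
transpose g = record
  { row = col ; col = row ; cell = λ i j → cell j i
  ; row-cell = λ i j → col-cell j i ; col-cell = λ i j → row-cell j i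
  ; cell-row-col = cell-row-col
  ; ∑-cells = λ F → trans (∑-cells F) (∑-comm (λ i j → F (cell i j)))
  }
  where open Grid g

productGrid : ∀ m → Grid (m * m) m
productGrid m = record
  { row = quotient m ; col = remainder {m} m ; cell = combine
  ; row-cell = λ i j → cong proj₁ (remQuot-combine i j)
  ; col-cell = λ i j → cong proj₂ (remQuot-combine i j)
  ; cell-row-col = combine-remQuot {m} m
  ; ∑-cells = ∑-combine m
  }

squareGrid : ∀ m → Grid (m ^ 2) m
squareGrid m = subst (λ N → Grid N m) (cong (m *_) (sym (*-identityʳ m))) (productGrid m)

module GridGraphs {N m : ℕ} (g : Grid N m) where
  open Grid g

  ≡-by-coordinates : ∀ {x y} → row x ≡ row y → col x ≡ col y → x ≡ y
  ≡-by-coordinates {x} {y} rx≡ry cx≡cy = begin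
    x                     ≡⟨ cell-row-col x ⟨
    cell (row x) (col x)  ≡⟨ cong (λ i → cell i (col x)) rx≡ry ⟩
    cell (row y) (col x)  ≡⟨ cong (cell (row y)) cx≡cy ⟩
    cell (row y) (col y)  ≡⟨ cell-row-col y ⟩
    y                     ∎

  rowSize : ∀ a → ∑[ x < N ] indicator ⌊ row x ≟ a ⌋ ≡ m
  rowSize a = begin
    ∑[ x < N ] indicator ⌊ row x ≟ a ⌋                      ≡⟨ ∑-cells _ ⟩
    ∑[ i < m ] ∑[ j < m ] indicator ⌊ row (cell i j) ≟ a ⌋
      ≡⟨ sum-cong-≗ {m} (λ i → sum-cong-≗ {m} λ j → cong (λ r → indicator ⌊ r ≟ a ⌋) (row-cell i j)) ⟩
    ∑[ i < m ] ∑[ j < m ] indicator ⌊ i ≟ a ⌋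
      ≡⟨ ∑-comm {m} {m} (λ i j → indicator ⌊ i ≟ a ⌋) ⟩
    ∑[ j < m ] ∑[ i < m ] indicator ⌊ i ≟ a ⌋
      ≡⟨ sum-cong-≗ {m} (λ j → ∑-single a λ i → indicator-no (i ≟ a)) ⟩
    ∑[ j < m ] indicator ⌊ a ≟ a ⌋
      ≡⟨ sum-cong-≗ {m} (λ j → indicator-yes (a ≟ a) refl) ⟩
    ∑[ j < m ] 1
      ≡⟨ ∑-ones m ⟩
    m ∎

  sameRow? : ∀ x y → Dec (row x ≡ row y × col x ≢ col y)
  sameRow? x y = (row x ≟ row y) ×-dec ¬? (col x ≟ col y)

  rowCliques : Graph N
  rowCliques = graphOf sameRow? (λ (r , c) → sym r , c ∘ sym) (λ x (_ , c) → c refl)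

  rowCliques-adj⁺ : ∀ {x y} → row x ≡ row y → col x ≢ col y → adj rowCliques x y ≡ true
  rowCliques-adj⁺ {x} {y} r c = dec-true (sameRow? x y) (r , c)

  rowCliques-adj⁻ : ∀ {x y} → adj rowCliques x y ≡ true → row x ≡ row y × col x ≢ col y
  rowCliques-adj⁻ {x} {y} = does≡true⇒ (sameRow? x y)

  complement-rowCliques-adj⁺ : ∀ {x y} → row x ≢ row y → adj (complement rowCliques) x y ≡ true
  complement-rowCliques-adj⁺ {x} {y} r =
    complement-adj⁺ rowCliques (r ∘ cong row) (dec-false (sameRow? x y) (r ∘ proj₁))

  complement-rowCliques-adj⁻ : ∀ {x y} → adj (complement rowCliques) x y ≡ true → row x ≢ row y
  complement-rowCliques-adj⁻ {x} {y} xy rx≡ry with complement-adj⁻ rowCliques xy | col x ≟ col y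
  ... | x≢y , _ | yes cx≡cy = x≢y (≡-by-coordinates rx≡ry cx≡cy)
  ... | _ , ¬xy | no cx≢cy = true≢false (trans (sym (rowCliques-adj⁺ rx≡ry cx≢cy)) ¬xy)

  sameLine? : ∀ x y → Dec (x ≢ y × (row x ≡ row y ⊎ col x ≡ col y))
  sameLine? x y = ¬? (x ≟ y) ×-dec (row x ≟ row y ⊎-dec col x ≟ col y)

  rook : Graph N
  rook = graphOf sameLine?
    (λ { (x≢y , inj₁ r) → x≢y ∘ sym , inj₁ (sym r) ; (x≢y , inj₂ c) → x≢y ∘ sym , inj₂ (sym c) })
    (λ x (x≢x , _) → x≢x refl)

  rook-adj⁺ : ∀ {x y} → x ≢ y → row x ≡ row y ⊎ col x ≡ col y → adj rook x y ≡ true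
  rook-adj⁺ {x} {y} x≢y line = dec-true (sameLine? x y) (x≢y , line)

  rook-adj⁻ : ∀ {x y} → adj rook x y ≡ true → x ≢ y × (row x ≡ row y ⊎ col x ≡ col y)
  rook-adj⁻ {x} {y} = does≡true⇒ (sameLine? x y)

  IsTensorSquare : Graph N → Set
  IsTensorSquare G = ∀ x y → adj G x y ≡ true ⇔ (row x ≢ row y × col x ≢ col y)

  complement-rook-isTensorSquare : IsTensorSquare (complement rook)
  complement-rook-isTensorSquare x y = mk⇔ differ both
    where
    differ : adj (complement rook) x y ≡ true → row x ≢ row y × col x ≢ col y
    differ xy with complement-adj⁻ rook xy
    ... | x≢y , ¬xy = (λ r → true≢false (trans (sym (rook-adj⁺ x≢y (inj₁ r))) ¬xy))
                    , (λ c → true≢false (trans (sym (rook-adj⁺ x≢y (inj₂ c))) ¬xy))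
    both : row x ≢ row y × col x ≢ col y → adj (complement rook) x y ≡ true
    both (r , c) = complement-adj⁺ rook (r ∘ cong row)
      (dec-false (sameLine? x y) λ { (_ , inj₁ r′) → r r′ ; (_ , inj₂ c′) → c c′ })

  rowCliques-χso : χso≡ rowCliques m
  rowCliques-χso =
    (col , proper , zeroOrOdd) , λ c soc → ≤-from-element λ a → clique⇒≤ rowCliques (cell a) (rowClique a) soc
    where
    proper : Proper rowCliques col
    proper x y xy = proj₂ (rowCliques-adj⁻ xy)
    zeroOrOdd : ∀ v c → ZeroOrOdd (colourCount rowCliques col v c)
    zeroOrOdd v c = colourCount-single-zeroOrOdd rowCliques col v c (cell (row v) c) λ x x≢t vx cx≡c →
      x≢t (≡-by-coordinates (trans (sym (proj₁ (rowCliques-adj⁻ vx))) (sym (row-cell _ _)))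
                            (trans cx≡c (sym (col-cell _ _))))
    rowClique : ∀ a {i j} → i ≢ j → adj rowCliques (cell a i) (cell a j) ≡ true
    rowClique a {i} {j} i≢j = rowCliques-adj⁺ (trans (row-cell a i) (sym (row-cell a j)))
      λ c → i≢j (trans (sym (col-cell a i)) (trans c (col-cell a j)))

  complement-rowCliques-χso : m % 2 ≡ 1 → χso≡ (complement rowCliques) m
  complement-rowCliques-χso odd =
    (row , (λ x y xy → complement-rowCliques-adj⁻ xy) , zeroOrOdd) ,
    λ c soc → ≤-from-element λ a → clique⇒≤ (complement rowCliques) (λ i → cell i a) (colClique a) soc
    where
    count : Fin N → Fin m → ℕ
    count v c = colourCount (complement rowCliques) row v c
    ownRow : ∀ v → count v (row v) ≡ 0
    ownRow v = trans (colourCount≡sum (complement rowCliques) row v (row v)) (∑-zero off)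
      where
      off : ∀ x → indicator (adj (complement rowCliques) v x ∧ ⌊ row x ≟ row v ⌋) ≡ 0
      off x with adj (complement rowCliques) v x in vx
      ... | false = refl
      ... | true = indicator-∧-no true (row x ≟ row v) (complement-rowCliques-adj⁻ vx ∘ sym)
    otherRow : ∀ v c → c ≢ row v → count v c ≡ m
    otherRow v c c≢rv =
      trans (colourCount≡sum (complement rowCliques) row v c) (trans (sum-cong-≗ {N} wholeRow) (rowSize c))
      where
      wholeRow : ∀ x → indicator (adj (complement rowCliques) v x ∧ ⌊ row x ≟ c ⌋) ≡ indicator ⌊ row x ≟ c ⌋
      wholeRow x with row x ≟ c
      ... | yes rx≡c = cong (λ b → indicator (b ∧ true))
                         (complement-rowCliques-adj⁺ λ rv≡rx → c≢rv (trans (sym rx≡c) (sym rv≡rx)))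
      ... | no _ = cong indicator (∧-zeroʳ _)
    zeroOrOdd : ∀ v c → ZeroOrOdd (count v c)
    zeroOrOdd v c with c ≟ row v
    ... | yes refl = inj₁ (ownRow v)
    ... | no c≢rv = inj₂ (trans (cong (_% 2) (otherRow v c c≢rv)) odd)
    colClique : ∀ a {i j} → i ≢ j → adj (complement rowCliques) (cell i a) (cell j a) ≡ true
    colClique a {i} {j} i≢j =
      complement-rowCliques-adj⁺ λ r → i≢j (trans (sym (row-cell i a)) (trans r (row-cell j a)))

  rook-colouring-injective : ∀ {c} (f : Fin N → Fin c) → IsStrongOddColouring rook f → Injective _≡_ _≡_ f
  rook-colouring-injective f (proper , zeroOrOdd) = distinct⇒injective clash
    where
    lineClash : ∀ {x y} → x ≢ y → row x ≡ row y ⊎ col x ≡ col y → f x ≢ f y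
    lineClash x≢y line = proper _ _ (rook-adj⁺ x≢y line)
    clash : ∀ {u v} → u ≢ v → f u ≢ f v
    clash {u} {v} u≢v fu≡fv with row u ≟ row v | col u ≟ col v
    ... | yes r | _ = lineClash u≢v (inj₁ r) fu≡fv
    ... | no _ | yes c = lineClash u≢v (inj₂ c) fu≡fv
    ... | no r | no c = ¬zeroOrOdd-2 (subst ZeroOrOdd count≡2 (zeroOrOdd w (f u)))
      where
      -- w sees u along its row and v along its column
      w : Fin N
      w = cell (row u) (col v)
      only-uv : ∀ x → x ≢ u → x ≢ v → adj rook w x ≡ true → f x ≢ f u
      only-uv x x≢u x≢v wx fx≡fu with proj₂ (rook-adj⁻ wx)
      ... | inj₁ rw≡rx = lineClash x≢u (inj₁ (trans (sym rw≡rx) (row-cell _ _))) fx≡fu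
      ... | inj₂ cw≡cx = lineClash x≢v (inj₂ (trans (sym cw≡cx) (col-cell _ _))) (trans fx≡fu fu≡fv)
      count≡2 : colourCount rook f w (f u) ≡ 2
      count≡2 = colourCount≡2 rook f w (f u) u≢v
        (rook-adj⁺ (λ w≡u → c (trans (sym (cong col w≡u)) (col-cell _ _))) (inj₁ (row-cell _ _)))
        (rook-adj⁺ (λ w≡v → r (trans (sym (row-cell _ _)) (cong row w≡v))) (inj₂ (col-cell _ _)))
        refl (sym fu≡fv) only-uv

  rook-χso : χso≡ rook N
  rook-χso = χso≡order rook rook-colouring-injective

  module TensorSquareColouring (G : Graph N) (tensor : IsTensorSquare G)
                               {c} (f : Fin N → Fin c) (soc : IsStrongOddColouring G f) where

    colourClass⊆row : ∀ {u v x} → row u ≡ row v → col u ≢ col v → f u ≡ f v → f x ≡ f u → row x ≡ row u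
    colourClass⊆row {u} {v} {x} ru≡rv cu≢cv fu≡fv fx≡fu with row x ≟ row u | col x ≟ col u
    ... | yes rx≡ru | _ = rx≡ru
    ... | no rx≢ru | no cx≢cu = ⊥-elim (proj₁ soc x u (from (tensor x u) (rx≢ru , cx≢cu)) fx≡fu)
    ... | no rx≢ru | yes cx≡cu = ⊥-elim (proj₁ soc x v
      (from (tensor x v) ((λ e → rx≢ru (trans e (sym ru≡rv))) , (λ e → cu≢cv (trans (sym cx≡cu) e))))
      (trans fx≡fu fu≡fv))

    classSize : Fin c → ℕ
    classSize d = ∑[ x < N ] indicator ⌊ f x ≟ d ⌋

    -- the neighbours of cell b j in the colour class are the class members off column j
    classSize-split : ∀ {a b d} → (∀ {x} → f x ≡ d → row x ≡ a) → b ≢ a → ∀ j →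
      classSize d ≡ indicator ⌊ f (cell a j) ≟ d ⌋ + colourCount G f (cell b j) d
    classSize-split {a} {b} {d} inRow b≢a j =
      trans (∑-except (cell a j) notAdjacent agree) (cong (_ +_) (sym (colourCount≡sum G f (cell b j) d)))
      where
      notAdjacent : indicator (adj G (cell b j) (cell a j) ∧ ⌊ f (cell a j) ≟ d ⌋) ≡ 0
      notAdjacent with adj G (cell b j) (cell a j) in e
      ... | false = refl
      ... | true = ⊥-elim (proj₂ (to (tensor _ _) e) (trans (col-cell b j) (sym (col-cell a j))))
      agree : ∀ x → x ≢ cell a j → indicator ⌊ f x ≟ d ⌋ ≡ indicator (adj G (cell b j) x ∧ ⌊ f x ≟ d ⌋)
      agree x x≢aj with f x ≟ d
      ... | no _ = sym (cong indicator (∧-zeroʳ _))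
      ... | yes fx≡d = cong (λ e → indicator (e ∧ true)) (sym (from (tensor _ _) (rows≢ , cols≢)))
        where
        rows≢ : row (cell b j) ≢ row x
        rows≢ e = b≢a (trans (sym (row-cell b j)) (trans e (inRow fx≡d)))
        cols≢ : col (cell b j) ≢ col x
        cols≢ e = x≢aj (≡-by-coordinates (trans (inRow fx≡d) (sym (row-cell a j)))
                                         (trans (sym e) (trans (col-cell b j) (sym (col-cell a j)))))

    -- Some count (col u) is odd and one less than the class size; the class size is itself odd: it equals
    -- a nonzero count if some cell of row a lies outside the class, and the row length m otherwise.
    sameRow-clash : m % 2 ≡ 1 → ∀ {u v} → row u ≡ row v → col u ≢ col v → f u ≢ f v
    sameRow-clash odd {u} {v} ru≡rv cu≢cv fu≡fv =
      odd⇒suc-even (count (col u)) countOdd (subst (λ k → k % 2 ≡ 1) classSize≡suc classOdd)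
      where
      a : Fin m
      a = row u
      d : Fin c
      d = f u
      inRow : ∀ {x} → f x ≡ d → row x ≡ a
      inRow = colourClass⊆row ru≡rv cu≢cv fu≡fv
      otherRow : Σ (Fin m) (_≢ a)
      otherRow with col u ≟ a
      ... | yes cu≡a = col v , λ cv≡a → cu≢cv (trans cu≡a (sym cv≡a))
      ... | no cu≢a = col u , cu≢a
      b : Fin m
      b = proj₁ otherRow
      count : Fin m → ℕ
      count j = colourCount G f (cell b j) d
      split : ∀ j → classSize d ≡ indicator ⌊ f (cell a j) ≟ d ⌋ + count j
      split = classSize-split inRow (proj₂ otherRow)
      classSize≡suc : classSize d ≡ suc (count (col u))
      classSize≡suc = trans (split (col u)) (cong (_+ count (col u))
        (trans (cong (λ x → indicator ⌊ f x ≟ d ⌋) (cell-row-col u)) (indicator-yes (f u ≟ d) refl)))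
      countOdd : count (col u) % 2 ≡ 1
      countOdd = zeroOrOdd⇒odd
        (colourCount-positive G f (cell b (col u)) d v
          (from (tensor _ _) ((λ e → proj₂ otherRow (trans (sym (row-cell _ _)) (trans e (sym ru≡rv))))
                            , (λ e → cu≢cv (trans (sym (col-cell _ _)) e))))
          (sym fu≡fv))
        (proj₂ soc _ d)
      classOdd : classSize d % 2 ≡ 1
      classOdd with all? (λ j → f (cell a j) ≟ d)
      ... | yes rowInClass = trans (cong (_% 2) (trans (sum-cong-≗ {N} classIsRow) (rowSize a))) odd
        where
        classIsRow : ∀ x → indicator ⌊ f x ≟ d ⌋ ≡ indicator ⌊ row x ≟ a ⌋
        classIsRow x = indicator-⇔ (mk⇔ inRow λ rx≡a → subst (λ y → f y ≡ d)
          (trans (cong (λ i → cell i (col x)) (sym rx≡a)) (cell-row-col x)) (rowInClass (col x)))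
          (f x ≟ d) (row x ≟ a)
      ... | no ¬rowInClass with ¬∀⟶∃¬ m _ (λ j → f (cell a j) ≟ d) ¬rowInClass
      ...   | j , fj≢d = subst (λ k → k % 2 ≡ 1) (sym classSize≡count) (zeroOrOdd⇒odd positive (proj₂ soc _ d))
        where
        classSize≡count : classSize d ≡ count j
        classSize≡count = trans (split j) (cong (_+ count j) (indicator-no (f (cell a j) ≟ d) fj≢d))
        positive : 0 < count j
        positive = subst (0 <_) (trans (sym classSize≡suc) classSize≡count) z<s

transpose-isTensorSquare : ∀ {N m} (g : Grid N m) {G : Graph N} →
  GridGraphs.IsTensorSquare g G → GridGraphs.IsTensorSquare (transpose g) G
transpose-isTensorSquare g tensor x y = mk⇔ (swap ∘ to (tensor x y)) (from (tensor x y) ∘ swap)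

tensorSquare-χso : ∀ {N m} (g : Grid N m) → m % 2 ≡ 1 →
  (G : Graph N) → GridGraphs.IsTensorSquare g G → χso≡ G N
tensorSquare-χso g odd G tensor = χso≡order G λ f soc → distinct⇒injective (clash f soc)
  where
  open Grid g
  open GridGraphs using (module TensorSquareColouring)
  clash : ∀ {c} (f : Fin _ → Fin c) → IsStrongOddColouring G f → ∀ {u v} → u ≢ v → f u ≢ f v
  clash f soc {u} {v} u≢v with row u ≟ row v | col u ≟ col v
  ... | yes r | yes c = ⊥-elim (u≢v (GridGraphs.≡-by-coordinates g r c))
  ... | yes r | no c = TensorSquareColouring.sameRow-clash g G tensor f soc odd r c
  ... | no r | yes c =
    TensorSquareColouring.sameRow-clash (transpose g) G (transpose-isTensorSquare g {G} tensor) f soc odd c r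
  ... | no r | no c = proj₁ soc u v (from (tensor u v) (r , c))

-- Arithmetic

square-gap : ∀ a d → 4 * (a * (a + d)) + d * d ≡ (a + (a + d)) * (a + (a + d))
square-gap = solve 2 (λ a d → con 4 :* (a :* (a :+ d)) :+ d :* d := (a :+ (a :+ d)) :* (a :+ (a :+ d))) refl
  where open +-*-Solver

am-gm-≤ : ∀ {a b} → a ≤ b → 4 * (a * b) ≤ (a + b) * (a + b)
am-gm-≤ {a} {b} a≤b = subst (λ b → 4 * (a * b) ≤ (a + b) * (a + b)) (m+[n∸m]≡n a≤b)
  (subst (4 * (a * (a + (b ∸ a))) ≤_) (square-gap a (b ∸ a)) (m≤m+n _ _))

am-gm : ∀ a b → 4 * (a * b) ≤ (a + b) * (a + b)
am-gm a b with ≤-total a b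
... | inj₁ a≤b = am-gm-≤ a≤b
... | inj₂ b≤a = subst₂ (λ x y → 4 * x ≤ y) (*-comm b a) (cong₂ _*_ (+-comm b a) (+-comm b a)) (am-gm-≤ b≤a)

sum-product-bounds : ∀ m {a b} → a ≤ m ^ 2 → b ≤ m ^ 2 → m ^ 2 ≤ a * b →
  (2 * m ≤ a + b) × (a + b ≤ 2 * m ^ 2) × (m ^ 2 ≤ a * b) × (a * b ≤ (m ^ 2) ^ 2)
sum-product-bounds m {a} {b} a≤N b≤N N≤ab =
  ≮⇒≥ (λ a+b<2m → <⇒≱ (*-mono-< a+b<2m a+b<2m) squares) ,
  +-mono-≤ a≤N (≤-trans b≤N (m≤m+n _ 0)) ,
  N≤ab ,
  *-mono-≤ a≤N (subst (b ≤_) (sym (*-identityʳ _)) b≤N)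
  where
  squares : (2 * m) * (2 * m) ≤ (a + b) * (a + b)
  squares = subst (_≤ (a + b) * (a + b)) (sym (double-square m)) (≤-trans (*-monoʳ-≤ 4 N≤ab) (am-gm a b))
    where
    double-square : ∀ m → (2 * m) * (2 * m) ≡ 4 * m ^ 2
    double-square = solve 1 (λ m → (con 2 :* m) :* (con 2 :* m) := con 4 :* (m :* (m :* con 1))) refl
      where open +-*-Solver

χso≤order : ∀ {n a} (G : Graph n) → χso≡ G a → a ≤ n
χso≤order G (_ , minimal) = minimal _ (hasSOC-order G)

theorem4p6 : (k : ℕ) →
    (∃[ H ] (χso≡ {(2 * k + 1) ^ 2} H (2 * k + 1) × χso≡ (complement H) (2 * k + 1)))
    × (∃[ H ] (χso≡ {(2 * k + 1) ^ 2} H ((2 * k + 1) ^ 2) × χso≡ (complement H) ((2 * k + 1) ^ 2)))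
    × (∀ (G : Graph ((2 * k + 1) ^ 2)) (a b : ℕ) → χso≡ G a → χso≡ (complement G) b →
          (2 * (2 * k + 1) ≤ a + b) × (a + b ≤ 2 * (2 * k + 1) ^ 2)
          × ((2 * k + 1) ^ 2 ≤ a * b) × (a * b ≤ ((2 * k + 1) ^ 2) ^ 2))
    × (∃[ G ] ∃[ a ] ∃[ b ] (χso≡ {(2 * k + 1) ^ 2} G a × χso≡ (complement G) b × a + b ≡ 2 * (2 * k + 1)))
    × (∃[ G ] ∃[ a ] ∃[ b ] (χso≡ {(2 * k + 1) ^ 2} G a × χso≡ (complement G) b × a + b ≡ 2 * (2 * k + 1) ^ 2))
    × (∃[ G ] ∃[ a ] ∃[ b ] (χso≡ {(2 * k + 1) ^ 2} G a × χso≡ (complement G) b × a * b ≡ (2 * k + 1) ^ 2))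
    × (∃[ G ] ∃[ a ] ∃[ b ] (χso≡ {(2 * k + 1) ^ 2} G a × χso≡ (complement G) b × a * b ≡ ((2 * k + 1) ^ 2) ^ 2))
theorem4p6 k =
  (rowCliques , χso-H₁ , χso-H̄₁) , (rook , χso-H₂ , χso-H̄₂) , bounds ,
  (rowCliques , m , m , χso-H₁ , χso-H̄₁ , double m) ,
  (rook , N , N , χso-H₂ , χso-H̄₂ , double N) ,
  (rowCliques , m , m , χso-H₁ , χso-H̄₁ , square m) ,
  (rook , N , N , χso-H₂ , χso-H̄₂ , square N)
  where
  m N : ℕ
  m = 2 * k + 1
  N = m ^ 2
  grid : Grid N m
  grid = squareGrid m
  open GridGraphs grid
  χso-H₁ : χso≡ rowCliques m
  χso-H₁ = rowCliques-χso
  χso-H̄₁ : χso≡ (complement rowCliques) m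
  χso-H̄₁ = complement-rowCliques-χso (2k+1-odd k)
  χso-H₂ : χso≡ rook N
  χso-H₂ = rook-χso
  χso-H̄₂ : χso≡ (complement rook) N
  χso-H̄₂ = tensorSquare-χso grid (2k+1-odd k) (complement rook) complement-rook-isTensorSquare
  bounds : ∀ (G : Graph N) a b → χso≡ G a → χso≡ (complement G) b →
    (2 * m ≤ a + b) × (a + b ≤ 2 * N) × (N ≤ a * b) × (a * b ≤ N ^ 2)
  bounds G a b χa χb = sum-product-bounds m (χso≤order G χa) (χso≤order (complement G) χb)
    (order≤χ*χ̄ G (proj₁ χa) (proj₁ χb))
  double : ∀ n → n + n ≡ 2 * n
  double n = cong (n +_) (sym (+-identityʳ n))
  square : ∀ n → n * n ≡ n ^ 2
  square n = cong (n *_) (sym (*-identityʳ n))
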